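{- Consider fully-dynamic edge orientation on $n$ vertices where at every time the current graph is a forest. The algorithm that orients each newly inserted edge arbitrarily and, after every update, runs \textsc{Path-Local-Search} with parameter $L=\log n$ until a local optimum is reached, maintains discrepancy $O(1)$ at all times with amortized recourse $O(\log n)$ per update.
   Context: For an orientation, $\mathrm{disc}(v)=|\delta_{\mathrm{in}}(v)|-|\delta_{\mathrm{out}}(v)|$ and the discrepancy is $\max_v|\mathrm{disc}(v)|$. \textsc{Path-Local-Search} with parameter $L$: while there is a directed path $(u_0,\dots,u_l)$ with $l\le L$ and $\mathrm{disc}(u_l)>\mathrm{disc}(u_0)+2$, reverse all edges of the path. Each update inserts or deletes one edge; amortized recourse is the total number of edge re-orientations divided by the number of updates. -}

module Defs where

open import Data.Nat using (ℕ; _≤_)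
open import Data.Integer as ℤ using (ℤ; +_)
open import Data.Fin using (Fin; _≟_)
open import Data.Product using (_×_; _,_; proj₁; proj₂; swap)
open import Data.List using (List; []; _∷_; _++_; length; filter; map; removeAt; lookup)
open import Data.List.Membership.Propositional using (_∈_)
open import Data.List.Relation.Binary.Permutation.Propositional using (_↭_)
open import Relation.Nullary using (¬_)

-- A directed edge (tail , head) on vertex set Fin n.
Edge : ℕ → Set
Edge n = Fin n × Fin n

Orientation : ℕ → Set
Orientation n = List (Edge n)

indeg : ∀ {n} → Orientation n → Fin n → ℕ
indeg o v = length (filter (λ e → proj₂ e ≟ v) o)

outdeg : ∀ {n} → Orientation n → Fin n → ℕ
outdeg o v = length (filter (λ e → proj₁ e ≟ v) o)

disc : ∀ {n} → Orientation n → Fin n → ℤ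
disc o v = (+ indeg o v) ℤ.- (+ outdeg o v)

data Reach {n} (E : Orientation n) : Fin n → Fin n → Set where
  here : ∀ {u} → Reach E u u
  fwd  : ∀ {x y w} → (x , y) ∈ E → Reach E y w → Reach E x w
  bwd  : ∀ {x y w} → (y , x) ∈ E → Reach E y w → Reach E x w

-- The underlying undirected (multi)graph is a forest (acyclic):
-- every edge is a bridge, i.e. its endpoints are disconnected once it is
-- removed (this also excludes self-loops and parallel edges).
Forest : ∀ {n} → Orientation n → Set
Forest E = ∀ (i : Fin (length E)) →
  ¬ Reach (removeAt E i) (proj₁ (lookup E i)) (proj₂ (lookup E i))

data Update (n : ℕ) : Set where
  insert : Fin n → Fin n → Update n
  delete : Fin n → Fin n → Update n

data Apply {n} : Orientation n → Update n → Orientation n → Set where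
  ins-uv : ∀ {o u v} → Apply o (insert u v) ((u , v) ∷ o)
  ins-vu : ∀ {o u v} → Apply o (insert u v) ((v , u) ∷ o)
  del-uv : ∀ {o o' u v} → o ↭ ((u , v) ∷ o') → Apply o (delete u v) o'
  del-vu : ∀ {o o' u v} → o ↭ ((v , u) ∷ o') → Apply o (delete u v) o'

data IsPath {n} : Fin n → List (Edge n) → Fin n → Set where
  nil  : ∀ {u} → IsPath u [] u
  cons : ∀ {u v w P} → IsPath v P w → IsPath u ((u , v) ∷ P) w

-- The ℕ index counts re-orientations.
data Flip {n} (L : ℕ) : Orientation n → ℕ → Orientation n → Set where
  flip : ∀ {o P R u w} → o ↭ (P ++ R) → IsPath u P w → length P ≤ L →
         disc o w ℤ.> disc o u ℤ.+ + 2 →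
         Flip L o (length P) (map swap P ++ R)

LocalOpt : ∀ {n} → ℕ → Orientation n → Set
LocalOpt {n} L o = ∀ (P R : List (Edge n)) (u w : Fin n) →
  o ↭ (P ++ R) → IsPath u P w → length P ≤ L →
  disc o w ℤ.≤ disc o u ℤ.+ + 2

data LS {n} (L : ℕ) : Orientation n → ℕ → Orientation n → Set where
  done : ∀ {o} → LocalOpt L o → LS L o 0 o
  step : ∀ {o o₁ o' m k} → Flip L o m o₁ → LS L o₁ k o' → LS L o (m Data.Nat.+ k) o'

-- An execution of the algorithm from the empty graph on a sequence of updates
-- (list stored newest-first), such that the graph is a forest after every
-- update.
data Exec {n} (L : ℕ) : List (Update n) → ℕ → Orientation n → Set where
  start : Exec L [] 0 []
  next  : ∀ {us k o upd o₁ m o₂} → Exec L us k o → Apply o upd o₁ → Forest o₁ →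
          LS L o₁ m o₂ → Exec L (upd ∷ us) (k Data.Nat.+ m) o₂

-- Amortisation uses the potential Φ = Σ_v disc(v)². Reversing an improving path u ⇝ w
-- (disc w ≥ disc u + 3) moves two units of discrepancy from w to u and lowers Φ by at
-- least 4, so L·Φ pays 4 for every edge of a path of length ≤ L; an update raises Φ by at
-- most 14 while all discrepancies lie in [−3, 3]. They do: at a local optimum of a forest a
-- vertex w with disc w ≥ 4 forces every vertex x with a path x ⇝ w of length ≤ L to have
-- disc x ≥ 2, hence two in-edges off that path. Following them builds a binary in-tree of
-- depth L = ⌈log₂ n⌉ whose 2^(L+1) > n vertices are distinct because the graph is a forest.
-- Reversing all edges gives the lower bound.

module Submission where

open import Defs
open import Data.Nat as ℕ using (ℕ; zero; suc; z≤n; s≤s; _^_)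
import Data.Nat.Properties as ℕP
import Data.Nat.Tactic.RingSolver as ℕSolver
open import Data.Nat.Logarithm using (⌈log₂_⌉)
open import Data.Nat.Logarithm.Core using (⌈log2⌉)
open import Data.Nat.Induction using (<-wellFounded)
open import Induction.WellFounded using (Acc; acc)
open import Data.Integer as ℤ using (ℤ; +_; -[1+_]; -1ℤ; ∣_∣; 0ℤ; 1ℤ; -_; _+_; _-_; _*_; _≤_; +≤+)
import Data.Integer.Properties as ℤP
open import Data.Integer.Tactic.RingSolver using (solve-∀)
open import Algebra.Properties.Semiring.Sum ℤP.+-*-semiring using (sum; ∑-distrib-+; *-distribˡ-sum; sum-cong-≗; sum-replicate-zero)
open import Data.Fin using (Fin; zero; suc; _≟_; _≤?_)
import Data.Fin.Properties as FinP
open import Data.Bool using (true; false; if_then_else_)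
open import Data.Product using (Σ; Σ-syntax; _×_; _,_; proj₁; proj₂; swap)
open import Data.Sum using (_⊎_; inj₁; inj₂; [_,_]′)
open import Data.Empty using (⊥-elim)
open import Function using (_∘_)
open import Data.List using (List; []; _∷_; [_]; _++_; length; filter; map; lookup; removeAt; reverse)
import Data.List.Properties as ListP
open import Data.List.Relation.Unary.Any as Any using (here; there)
import Data.List.Relation.Unary.Any.Properties as AnyP
open import Data.List.Membership.Propositional using (_∈_)
open import Data.List.Membership.Propositional.Properties using (∈-++⁺ʳ; ∈-map⁺; ∈-map⁻; ∈-lookup)
open import Data.List.Relation.Unary.All as All using (All; []; _∷_)
import Data.List.Relation.Unary.All.Properties as AllP
import Data.List.Relation.Unary.AllPairs.Properties as AllPairsP
open import Data.List.Relation.Unary.Unique.Propositional using (Unique; []; _∷_)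
open import Data.List.Relation.Binary.Subset.Propositional using (_⊆_)
open import Data.List.Relation.Binary.Permutation.Propositional as ↭ using (_↭_; ↭-refl; ↭-sym; ↭-trans; ↭-reflexive)
import Data.List.Relation.Binary.Permutation.Propositional.Properties as ↭P
open import Relation.Nullary using (¬_; does; yes; no)
open import Relation.Binary.PropositionalEquality using (_≡_; _≢_; refl; sym; trans; cong; cong₂; subst; module ≡-Reasoning)

private variable
  n : ℕ

-- Inequalities in ℤ are proved by exhibiting j - i as a sum of visibly nonnegative
-- terms, the identity itself being left to the ring solver.
≤-by-slack : ∀ {i j} s → 0ℤ ≤ s → j - i ≡ s → i ≤ j
≤-by-slack s 0≤s j-i≡s = ℤP.0≤i-j⇒j≤i (subst (0ℤ ≤_) (sym j-i≡s) 0≤s)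

0≤i*j : ∀ {i j} → 0ℤ ≤ i → 0ℤ ≤ j → 0ℤ ≤ i * j
0≤i*j {+ m} {+ k} _ _ = subst (0ℤ ≤_) (ℤP.pos-* m k) (+≤+ z≤n)

0≤i*i : ∀ i → 0ℤ ≤ i * i
0≤i*i (+ m)    = 0≤i*j {+ m} (+≤+ z≤n) (+≤+ z≤n)
0≤i*i -[1+ m ] = subst (0ℤ ≤_) (sym (ℤP.+◃n≡+n (suc m ℕ.* suc m))) (+≤+ z≤n)

-- Discrepancy

δ : Fin n → Fin n → ℤ
δ a v = if does (a ≟ v) then 1ℤ else 0ℤ

δ-diag : (a : Fin n) → δ a a ≡ 1ℤ
δ-diag zero    = refl
δ-diag (suc a) = δ-diag a

0≤δ : (a v : Fin n) → 0ℤ ≤ δ a v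
0≤δ a v with does (a ≟ v)
... | true  = +≤+ z≤n
... | false = +≤+ z≤n

δ≤1 : (a v : Fin n) → δ a v ≤ 1ℤ
δ≤1 a v with does (a ≟ v)
... | true  = +≤+ (s≤s z≤n)
... | false = +≤+ z≤n

disc₁ : Fin n → Fin n → Fin n → ℤ
disc₁ a b v = δ b v - δ a v

indeg-++ : (xs ys : Orientation n) (v : Fin n) → indeg (xs ++ ys) v ≡ indeg xs v ℕ.+ indeg ys v
indeg-++ xs ys v = trans (cong length (ListP.filter-++ _ xs ys)) (ListP.length-++ (filter _ xs))

outdeg-++ : (xs ys : Orientation n) (v : Fin n) → outdeg (xs ++ ys) v ≡ outdeg xs v ℕ.+ outdeg ys v
outdeg-++ xs ys v = trans (cong length (ListP.filter-++ _ xs ys)) (ListP.length-++ (filter _ xs))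

disc-++ : (xs ys : Orientation n) (v : Fin n) → disc (xs ++ ys) v ≡ disc xs v + disc ys v
disc-++ xs ys v = begin
  + indeg (xs ++ ys) v - + outdeg (xs ++ ys) v
    ≡⟨ cong₂ (λ i o → + i - + o) (indeg-++ xs ys v) (outdeg-++ xs ys v) ⟩
  + (indeg xs v ℕ.+ indeg ys v) - + (outdeg xs v ℕ.+ outdeg ys v)
    ≡⟨ cong₂ _-_ (ℤP.pos-+ (indeg xs v) _) (ℤP.pos-+ (outdeg xs v) _) ⟩
  (+ indeg xs v + + indeg ys v) - (+ outdeg xs v + + outdeg ys v)
    ≡⟨ regroup (+ indeg xs v) (+ indeg ys v) (+ outdeg xs v) (+ outdeg ys v) ⟩
  disc xs v + disc ys v ∎
  where
  open ≡-Reasoning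
  regroup : ∀ a b c d → (a + b) - (c + d) ≡ (a - c) + (b - d)
  regroup = solve-∀

disc-↭ : {xs ys : Orientation n} → xs ↭ ys → (v : Fin n) → disc xs v ≡ disc ys v
disc-↭ p v = cong₂ (λ i o → + i - + o) (↭P.↭-length (↭P.filter-↭ _ p)) (↭P.↭-length (↭P.filter-↭ _ p))

disc-singleton : (e : Edge n) (v : Fin n) → disc [ e ] v ≡ disc₁ (proj₁ e) (proj₂ e) v
disc-singleton (a , b) v with does (b ≟ v) | does (a ≟ v)
... | true  | true  = refl
... | true  | false = refl
... | false | true  = refl
... | false | false = refl

disc-∷ : (e : Edge n) (xs : Orientation n) (v : Fin n) → disc (e ∷ xs) v ≡ disc₁ (proj₁ e) (proj₂ e) v + disc xs v
disc-∷ e xs v = trans (disc-++ [ e ] xs v) (cong (_+ disc xs v) (disc-singleton e v))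

indeg-map-swap : (xs : Orientation n) (v : Fin n) → indeg (map swap xs) v ≡ outdeg xs v
indeg-map-swap []            v = refl
indeg-map-swap ((a , b) ∷ xs) v with does (a ≟ v)
... | true  = cong suc (indeg-map-swap xs v)
... | false = indeg-map-swap xs v

outdeg-map-swap : (xs : Orientation n) (v : Fin n) → outdeg (map swap xs) v ≡ indeg xs v
outdeg-map-swap []            v = refl
outdeg-map-swap ((a , b) ∷ xs) v with does (b ≟ v)
... | true  = cong suc (outdeg-map-swap xs v)
... | false = outdeg-map-swap xs v

disc-map-swap : (xs : Orientation n) (v : Fin n) → disc (map swap xs) v ≡ - disc xs v
disc-map-swap xs v = trans (cong₂ (λ i o → + i - + o) (indeg-map-swap xs v) (outdeg-map-swap xs v))
                           (antisym (+ indeg xs v) (+ outdeg xs v))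
  where
  antisym : ∀ i o → o - i ≡ - (i - o)
  antisym = solve-∀

disc-path : ∀ {u w : Fin n} {P} → IsPath u P w → (v : Fin n) → disc P v ≡ disc₁ u w v
disc-path {u = u} nil v = telescope (δ u v)
  where
  telescope : ∀ d → 0ℤ ≡ d - d
  telescope = solve-∀
disc-path {u = u} {w} (cons {v = x} {P = P} path) v = begin
  disc ((u , x) ∷ P) v          ≡⟨ disc-∷ (u , x) P v ⟩
  disc₁ u x v + disc P v        ≡⟨ cong (λ d → disc₁ u x v + d) (disc-path path v) ⟩
  disc₁ u x v + disc₁ x w v     ≡⟨ telescope (δ u v) (δ x v) (δ w v) ⟩
  disc₁ u w v ∎
  where
  open ≡-Reasoning
  telescope : ∀ a b c → (b - a) + (c - b) ≡ c - a
  telescope = solve-∀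

disc-reverse-path : ∀ {o P R : Orientation n} {u w} → o ↭ P ++ R → IsPath u P w → (v : Fin n) →
  disc (map swap P ++ R) v ≡ disc o v + (- + 2) * disc₁ u w v
disc-reverse-path {o = o} {P} {R} {u} {w} o↭PR path v = begin
  disc (map swap P ++ R) v     ≡⟨ disc-++ (map swap P) R v ⟩
  disc (map swap P) v + disc R v ≡⟨ cong (_+ disc R v) (disc-map-swap P v) ⟩
  - disc P v + disc R v        ≡⟨ shift (disc P v) (disc R v) ⟩
  (disc P v + disc R v) + (- + 2) * disc P v
    ≡⟨ cong₂ (λ d p → d + (- + 2) * p) (sym (trans (disc-↭ o↭PR v) (disc-++ P R v))) (disc-path path v) ⟩
  disc o v + (- + 2) * disc₁ u w v ∎
  where
  open ≡-Reasoning
  shift : ∀ p r → - p + r ≡ (p + r) + (- + 2) * p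
  shift = solve-∀

-- The potential Φ = Σ disc²

sum-nonneg : (f : Fin n → ℤ) → (∀ x → 0ℤ ≤ f x) → 0ℤ ≤ sum f
sum-nonneg {zero}  f _   = +≤+ z≤n
sum-nonneg {suc n} f 0≤f = ℤP.+-mono-≤ (0≤f zero) (sum-nonneg (λ x → f (suc x)) (λ x → 0≤f (suc x)))

sum-*-δ : (f : Fin n → ℤ) (a : Fin n) → sum (λ x → f x * δ a x) ≡ f a
sum-*-δ {suc n} f zero = begin
  f zero * 1ℤ + sum (λ x → f (suc x) * 0ℤ)
    ≡⟨ cong₂ _+_ (ℤP.*-identityʳ (f zero)) (sum-cong-≗ {n} (λ x → ℤP.*-zeroʳ (f (suc x)))) ⟩
  f zero + sum {n} (λ _ → 0ℤ)
    ≡⟨ cong (λ s → f zero + s) (sum-replicate-zero n) ⟩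
  f zero + 0ℤ
    ≡⟨ ℤP.+-identityʳ (f zero) ⟩
  f zero ∎
  where open ≡-Reasoning
sum-*-δ {suc n} f (suc a) = begin
  f zero * 0ℤ + sum (λ x → f (suc x) * δ a x) ≡⟨ cong (_+ sum (λ x → f (suc x) * δ a x)) (ℤP.*-zeroʳ (f zero)) ⟩
  0ℤ + sum (λ x → f (suc x) * δ a x)          ≡⟨ ℤP.+-identityˡ _ ⟩
  sum (λ x → f (suc x) * δ a x)               ≡⟨ sum-*-δ (λ x → f (suc x)) a ⟩
  f (suc a) ∎
  where open ≡-Reasoning

sum-*-disc₁ : (f : Fin n → ℤ) (a b : Fin n) → sum (λ x → f x * disc₁ a b x) ≡ f b - f a
sum-*-disc₁ {n} f a b = begin
  sum (λ x → f x * disc₁ a b x)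
    ≡⟨ sum-cong-≗ {n} (λ x → split (f x) (δ b x) (δ a x)) ⟩
  sum (λ x → f x * δ b x + -1ℤ * (f x * δ a x))
    ≡⟨ ∑-distrib-+ {n} _ _ ⟩
  sum (λ x → f x * δ b x) + sum (λ x → -1ℤ * (f x * δ a x))
    ≡⟨ cong (λ s → sum (λ x → f x * δ b x) + s) (sym (*-distribˡ-sum {n} -1ℤ _)) ⟩
  sum (λ x → f x * δ b x) + -1ℤ * sum (λ x → f x * δ a x)
    ≡⟨ cong₂ (λ p q → p + -1ℤ * q) (sum-*-δ f b) (sum-*-δ f a) ⟩
  f b + -1ℤ * f a
    ≡⟨ minus (f b) (f a) ⟩
  f b - f a ∎
  where
  open ≡-Reasoning
  split : ∀ y p q → y * (p - q) ≡ y * p + -1ℤ * (y * q)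
  split = solve-∀
  minus : ∀ p q → p + -1ℤ * q ≡ p - q
  minus = solve-∀

Φ : (Fin n → ℤ) → ℤ
Φ f = sum (λ x → f x * f x)

0≤Φ : (f : Fin n → ℤ) → 0ℤ ≤ Φ f
0≤Φ f = sum-nonneg _ (λ x → 0≤i*i (f x))

Φ-cong : {f g : Fin n → ℤ} → (∀ x → f x ≡ g x) → Φ f ≡ Φ g
Φ-cong {n} f≗g = sum-cong-≗ {n} (λ x → cong₂ _*_ (f≗g x) (f≗g x))

Φ-+-* : (f g : Fin n → ℤ) (c : ℤ) →
  Φ (λ x → f x + c * g x) ≡ Φ f + + 2 * c * sum (λ x → f x * g x) + c * c * Φ g
Φ-+-* {n} f g c = begin
  Φ (λ x → f x + c * g x)
    ≡⟨ sum-cong-≗ {n} (λ x → expand c (f x) (g x)) ⟩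
  sum (λ x → f x * f x + (+ 2 * c * (f x * g x) + c * c * (g x * g x)))
    ≡⟨ ∑-distrib-+ {n} _ _ ⟩
  Φ f + sum (λ x → + 2 * c * (f x * g x) + c * c * (g x * g x))
    ≡⟨ cong (λ s → Φ f + s) (∑-distrib-+ {n} _ _) ⟩
  Φ f + (sum (λ x → + 2 * c * (f x * g x)) + sum (λ x → c * c * (g x * g x)))
    ≡⟨ cong₂ (λ p q → Φ f + (p + q)) (sym (*-distribˡ-sum {n} (+ 2 * c) _)) (sym (*-distribˡ-sum {n} (c * c) _)) ⟩
  Φ f + (+ 2 * c * sum (λ x → f x * g x) + c * c * Φ g)
    ≡⟨ ℤP.+-assoc (Φ f) _ _ ⟨
  Φ f + + 2 * c * sum (λ x → f x * g x) + c * c * Φ g ∎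
  where
  open ≡-Reasoning
  expand : ∀ c y z → (y + c * z) * (y + c * z) ≡ y * y + (+ 2 * c * (y * z) + c * c * (z * z))
  expand = solve-∀

disc₁-spread : (a b : Fin n) → disc₁ a b b - disc₁ a b a ≤ + 2
disc₁-spread a b = ≤-by-slack (δ a b + δ b a) (ℤP.+-mono-≤ (0≤δ a b) (0≤δ b a))
  (begin
    + 2 - ((δ b b - δ a b) - (δ b a - δ a a))
      ≡⟨ cong₂ (λ p q → + 2 - ((p - δ a b) - (δ b a - q))) (δ-diag b) (δ-diag a) ⟩
    + 2 - ((1ℤ - δ a b) - (δ b a - 1ℤ))
      ≡⟨ slack (δ a b) (δ b a) ⟩
    δ a b + δ b a ∎)
  where
  open ≡-Reasoning
  slack : ∀ p q → + 2 - ((1ℤ - p) - (q - 1ℤ)) ≡ p + q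
  slack = solve-∀

Φ-shift : (f : Fin n → ℤ) (c : ℤ) (a b : Fin n) →
  Φ (λ x → f x + c * disc₁ a b x) ≤ Φ f + + 2 * c * (f b - f a) + + 2 * (c * c)
Φ-shift f c a b = begin
  Φ (λ x → f x + c * disc₁ a b x)
    ≡⟨ Φ-+-* f (disc₁ a b) c ⟩
  Φ f + + 2 * c * sum (λ x → f x * disc₁ a b x) + c * c * Φ (disc₁ a b)
    ≡⟨ cong₂ (λ p q → Φ f + + 2 * c * p + c * c * q) (sum-*-disc₁ f a b) (sum-*-disc₁ (disc₁ a b) a b) ⟩
  Φ f + + 2 * c * (f b - f a) + c * c * (disc₁ a b b - disc₁ a b a)
    ≤⟨ ℤP.+-monoʳ-≤ (Φ f + + 2 * c * (f b - f a)) c²-spread ⟩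
  Φ f + + 2 * c * (f b - f a) + + 2 * (c * c) ∎
  where
  open ℤP.≤-Reasoning
  c²-spread : c * c * (disc₁ a b b - disc₁ a b a) ≤ + 2 * (c * c)
  c²-spread = subst (c * c * (disc₁ a b b - disc₁ a b a) ≤_) (ℤP.*-comm (c * c) (+ 2))
    (ℤP.*-monoˡ-≤-nonNeg (c * c) {{ℤ.nonNegative (0≤i*i c)}} (disc₁-spread a b))

-- Connectivity and acyclicity

Reach-trans : ∀ {E : Orientation n} {x y z} → Reach E x y → Reach E y z → Reach E x z
Reach-trans here        r = r
Reach-trans (fwd e∈ r₁) r = fwd e∈ (Reach-trans r₁ r)
Reach-trans (bwd e∈ r₁) r = bwd e∈ (Reach-trans r₁ r)

infixl 6 _▷_
_▷_ : ∀ {E : Orientation n} {x a b} → Reach E x a → (a , b) ∈ E → Reach E x b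
r ▷ ab∈E = Reach-trans r (fwd ab∈E here)

Reach-sym : ∀ {E : Orientation n} {x y} → Reach E x y → Reach E y x
Reach-sym here       = here
Reach-sym (fwd e∈ r) = Reach-trans (Reach-sym r) (bwd e∈ here)
Reach-sym (bwd e∈ r) = Reach-trans (Reach-sym r) (fwd e∈ here)

Reach-map : ∀ {A B : Orientation n} → (∀ {a b} → (a , b) ∈ A → (a , b) ∈ B ⊎ (b , a) ∈ B) →
  ∀ {x y} → Reach A x y → Reach B x y
Reach-map A⊆B here = here
Reach-map A⊆B (fwd e∈ r) with A⊆B e∈
... | inj₁ e∈B = fwd e∈B (Reach-map A⊆B r)
... | inj₂ e∈B = bwd e∈B (Reach-map A⊆B r)
Reach-map A⊆B (bwd e∈ r) with A⊆B e∈
... | inj₁ e∈B = bwd e∈B (Reach-map A⊆B r)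
... | inj₂ e∈B = fwd e∈B (Reach-map A⊆B r)

Reach-mono : ∀ {A B : Orientation n} → A ⊆ B → ∀ {x y} → Reach A x y → Reach B x y
Reach-mono A⊆B = Reach-map (λ e∈ → inj₁ (A⊆B e∈))

Reach-↭ : ∀ {A B : Orientation n} → A ↭ B → ∀ {x y} → Reach A x y → Reach B x y
Reach-↭ A↭B = Reach-mono (↭P.∈-resp-↭ A↭B)

Reach-∷⁻ : ∀ {Q : Orientation n} {p q y z} → Reach ((p , q) ∷ Q) y z →
  Reach Q y z ⊎ (Reach Q y p × Reach Q q z) ⊎ (Reach Q y q × Reach Q p z)
Reach-∷⁻ here = inj₁ here
Reach-∷⁻ (fwd (there e∈) r) with Reach-∷⁻ r
... | inj₁ r′               = inj₁ (fwd e∈ r′)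
... | inj₂ (inj₁ (r₁ , r₂)) = inj₂ (inj₁ (fwd e∈ r₁ , r₂))
... | inj₂ (inj₂ (r₁ , r₂)) = inj₂ (inj₂ (fwd e∈ r₁ , r₂))
Reach-∷⁻ (bwd (there e∈) r) with Reach-∷⁻ r
... | inj₁ r′               = inj₁ (bwd e∈ r′)
... | inj₂ (inj₁ (r₁ , r₂)) = inj₂ (inj₁ (bwd e∈ r₁ , r₂))
... | inj₂ (inj₂ (r₁ , r₂)) = inj₂ (inj₂ (bwd e∈ r₁ , r₂))
Reach-∷⁻ (fwd (here refl) r) with Reach-∷⁻ r
... | inj₁ r′               = inj₂ (inj₁ (here , r′))
... | inj₂ (inj₁ (_ , r₂))  = inj₂ (inj₁ (here , r₂))
... | inj₂ (inj₂ (_ , r₂))  = inj₁ r₂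
Reach-∷⁻ (bwd (here refl) r) with Reach-∷⁻ r
... | inj₁ r′               = inj₂ (inj₂ (here , r′))
... | inj₂ (inj₁ (_ , r₂))  = inj₁ r₂
... | inj₂ (inj₂ (_ , r₂))  = inj₂ (inj₂ (here , r₂))

-- Defs.Forest, stated invariantly under reordering of the edge list.
Acyclic : Orientation n → Set
Acyclic E = ∀ e Q → E ↭ e ∷ Q → ¬ Reach Q (proj₁ e) (proj₂ e)

Acyclic-↭ : ∀ {A B : Orientation n} → A ↭ B → Acyclic A → Acyclic B
Acyclic-↭ A↭B acyclic e Q B↭eQ = acyclic e Q (↭-trans A↭B B↭eQ)

Acyclic-++⁻ʳ : ∀ (P : Orientation n) {R} → Acyclic (P ++ R) → Acyclic R
Acyclic-++⁻ʳ P acyclic e Q R↭eQ r =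
  acyclic e (P ++ Q) (↭-trans (↭P.++⁺ˡ P R↭eQ) (↭P.shift e P Q)) (Reach-mono (∈-++⁺ʳ P) r)

↭-removeAt : ∀ {e} {E : Orientation n} (e∈E : e ∈ E) → E ↭ e ∷ removeAt E (Any.index e∈E)
↭-removeAt (here refl)              = ↭-refl
↭-removeAt {E = f ∷ _} (there e∈E) = ↭-trans (↭.prep f (↭-removeAt e∈E)) (↭.swap f _ ↭-refl)

Forest⇒Acyclic : {E : Orientation n} → Forest E → Acyclic E
Forest⇒Acyclic {E = E} forest e Q E↭eQ Q-path =
  forest i (subst (λ f → Reach (removeAt E i) (proj₁ f) (proj₂ f)) (AnyP.lookup-index e∈E) (Reach-↭ Q↭rest Q-path))
  where
  e∈E : e ∈ E
  e∈E = ↭P.∈-resp-↭ (↭-sym E↭eQ) (here refl)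
  i = Any.index e∈E
  Q↭rest : Q ↭ removeAt E i
  Q↭rest = ↭P.drop-∷ (↭-trans (↭-sym E↭eQ) (↭-removeAt e∈E))

undirected : Edge n → Edge n
undirected (a , b) with a ≤? b
... | yes _ = (a , b)
... | no _  = (b , a)

undirected≡ : (e : Edge n) → undirected e ≡ e ⊎ undirected e ≡ swap e
undirected≡ (a , b) with a ≤? b
... | yes _ = inj₁ refl
... | no _  = inj₂ refl

undirected-swap : (e : Edge n) → undirected (swap e) ≡ undirected e
undirected-swap (a , b) with b ≤? a | a ≤? b
... | yes b≤a | yes a≤b = cong₂ _,_ (FinP.≤-antisym b≤a a≤b) (FinP.≤-antisym a≤b b≤a)
... | yes _   | no _    = refl
... | no _    | yes _   = refl
... | no b≰a  | no a≰b  = ⊥-elim ([ a≰b , b≰a ]′ (FinP.≤-total a b))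

Reach-undirected-ends⁺ : ∀ {Q : Orientation n} e → Reach Q (proj₁ e) (proj₂ e) →
  Reach Q (proj₁ (undirected e)) (proj₂ (undirected e))
Reach-undirected-ends⁺ (a , b) r with a ≤? b
... | yes _ = r
... | no _  = Reach-sym r

Reach-undirected-ends⁻ : ∀ {Q : Orientation n} e → Reach Q (proj₁ (undirected e)) (proj₂ (undirected e)) →
  Reach Q (proj₁ e) (proj₂ e)
Reach-undirected-ends⁻ (a , b) r with a ≤? b
... | yes _ = r
... | no _  = Reach-sym r

Reach-undirected⁺ : ∀ {Q : Orientation n} {x y} → Reach Q x y → Reach (map undirected Q) x y
Reach-undirected⁺ {Q = Q} = Reach-map orient
  where
  orient : ∀ {a b} → (a , b) ∈ Q → (a , b) ∈ map undirected Q ⊎ (b , a) ∈ map undirected Q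
  orient {a} {b} ab∈Q with undirected≡ (a , b)
  ... | inj₁ eq = inj₁ (subst (_∈ map undirected Q) eq (∈-map⁺ undirected ab∈Q))
  ... | inj₂ eq = inj₂ (subst (_∈ map undirected Q) eq (∈-map⁺ undirected ab∈Q))

Reach-undirected⁻ : ∀ {Q : Orientation n} {x y} → Reach (map undirected Q) x y → Reach Q x y
Reach-undirected⁻ {Q = Q} = Reach-map orient
  where
  orient : ∀ {a b} → (a , b) ∈ map undirected Q → (a , b) ∈ Q ⊎ (b , a) ∈ Q
  orient ab∈ with ∈-map⁻ undirected ab∈
  ... | e , e∈Q , refl with undirected≡ e
  ... | inj₁ eq = inj₁ (subst (_∈ Q) (sym eq) e∈Q)
  ... | inj₂ eq = inj₂ (subst (_∈ Q) (cong swap (sym eq)) e∈Q)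

Acyclic-undirected⁺ : {E : Orientation n} → Acyclic E → Acyclic (map undirected E)
Acyclic-undirected⁺ {E = E} acyclic f Q′ UE↭fQ′ r with ∈-map⁻ undirected (↭P.∈-resp-↭ (↭-sym UE↭fQ′) (here refl))
... | e , e∈E , refl = acyclic e rest (↭-removeAt e∈E)
  (Reach-undirected-ends⁻ e (Reach-undirected⁻ (Reach-↭ Q′↭Urest r)))
  where
  rest = removeAt E (Any.index e∈E)
  Q′↭Urest : Q′ ↭ map undirected rest
  Q′↭Urest = ↭P.drop-∷ (↭-trans (↭-sym UE↭fQ′) (↭P.map⁺ undirected (↭-removeAt e∈E)))

Acyclic-undirected⁻ : {E : Orientation n} → Acyclic (map undirected E) → Acyclic E
Acyclic-undirected⁻ acyclic e Q E↭eQ r =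
  acyclic (undirected e) (map undirected Q) (↭P.map⁺ undirected E↭eQ) (Reach-undirected-ends⁺ e (Reach-undirected⁺ r))

SameGraph : Orientation n → Orientation n → Set
SameGraph A B = map undirected A ↭ map undirected B

Acyclic-SameGraph : ∀ {A B : Orientation n} → SameGraph A B → Acyclic A → Acyclic B
Acyclic-SameGraph A∼B = Acyclic-undirected⁻ ∘ Acyclic-↭ A∼B ∘ Acyclic-undirected⁺

-- In-trees at a local optimum

n≤2^⌈log2⌉ : ∀ m (rec : Acc ℕ._<_ m) → m ℕ.≤ 2 ^ ⌈log2⌉ m rec
n≤2^⌈log2⌉ 0             _        = z≤n
n≤2^⌈log2⌉ 1             _        = s≤s z≤n
n≤2^⌈log2⌉ (suc (suc m)) (acc rs) = begin
  2 ℕ.+ m                                       ≡⟨ cong (2 ℕ.+_) (ℕP.⌊n/2⌋+⌈n/2⌉≡n m) ⟨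
  2 ℕ.+ (ℕ.⌊ m /2⌋ ℕ.+ c)                        ≤⟨ ℕP.+-monoʳ-≤ 2 (ℕP.+-monoˡ-≤ c (ℕP.⌊n/2⌋≤⌈n/2⌉ m)) ⟩
  2 ℕ.+ (c ℕ.+ c)                                ≡⟨ double c ⟩
  2 ℕ.* suc c                                    ≤⟨ ℕP.*-monoʳ-≤ 2 (n≤2^⌈log2⌉ (suc c) (rs (ℕP.⌈n/2⌉<n m))) ⟩
  2 ℕ.* 2 ^ ⌈log2⌉ (suc c) (rs (ℕP.⌈n/2⌉<n m)) ∎
  where
  open ℕP.≤-Reasoning
  c = ℕ.⌈ m /2⌉
  double : ∀ c → 2 ℕ.+ (c ℕ.+ c) ≡ 2 ℕ.* suc c
  double = ℕSolver.solve-∀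

n≤2^⌈log₂n⌉ : ∀ m → m ℕ.≤ 2 ^ ⌈log₂ m ⌉
n≤2^⌈log₂n⌉ m = n≤2^⌈log2⌉ m (<-wellFounded m)

lookup-injective : {V : List (Fin n)} → Unique V → ∀ {i j} → lookup V i ≡ lookup V j → i ≡ j
lookup-injective (_ ∷ _)      {zero}  {zero}  _  = refl
lookup-injective (x∉V ∷ _)    {zero}  {suc j} eq = ⊥-elim (All.lookup x∉V (∈-lookup j) eq)
lookup-injective (x∉V ∷ _)    {suc i} {zero}  eq = ⊥-elim (All.lookup x∉V (∈-lookup i) (sym eq))
lookup-injective (_ ∷ unique) {suc i} {suc j} eq = cong suc (lookup-injective unique eq)

Unique⇒length≤ : {V : List (Fin n)} → Unique V → length V ℕ.≤ n
Unique⇒length≤ unique = FinP.injective⇒≤ (lookup-injective unique)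

record ManyConnected (j : ℕ) (R : Orientation n) (x : Fin n) : Set where
  constructor many
  field
    vertices  : List (Fin n)
    unique    : Unique vertices
    big       : 2 ^ suc j ℕ.≤ length vertices
    connected : All (λ v → Reach R v x) vertices

ManyConnected-↭ : ∀ {j} {A B : Orientation n} {x} → A ↭ B → ManyConnected j A x → ManyConnected j B x
ManyConnected-↭ A↭B (many V unique big connected) = many V unique big (All.map (Reach-↭ A↭B) connected)

module Fork {a₁ a₂ x : Fin n} {Q : Orientation n} (acyclic : Acyclic ((a₁ , x) ∷ (a₂ , x) ∷ Q)) where

  bridge₁ : ¬ Reach ((a₂ , x) ∷ Q) a₁ x
  bridge₁ = acyclic (a₁ , x) _ ↭-refl

  bridge₂ : ¬ Reach ((a₁ , x) ∷ Q) a₂ x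
  bridge₂ = acyclic (a₂ , x) _ (↭.swap (a₁ , x) (a₂ , x) ↭-refl)

  disjoint : ∀ {v} → Reach ((a₂ , x) ∷ Q) v a₁ → ¬ Reach ((a₁ , x) ∷ Q) v a₂
  disjoint v~a₁ v~a₂ with Reach-∷⁻ v~a₂
  ... | inj₁ v~a₂′               = bridge₁ (Reach-trans (Reach-sym v~a₁) (Reach-mono there v~a₂′ ▷ here refl))
  ... | inj₂ (inj₁ (_ , x~a₂))   = bridge₂ (Reach-sym (Reach-mono there x~a₂))
  ... | inj₂ (inj₂ (_ , a₁~a₂))  = bridge₁ (Reach-mono there a₁~a₂ ▷ here refl)

  base : ManyConnected 0 ((a₁ , x) ∷ (a₂ , x) ∷ Q) x
  base = many (x ∷ a₁ ∷ []) ((x≢a₁ ∷ []) ∷ [] ∷ []) ℕP.≤-refl (here ∷ here ▷ here refl ∷ [])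
    where
    x≢a₁ : x ≢ a₁
    x≢a₁ refl = bridge₁ here

  join : ∀ {j} → ManyConnected j ((a₂ , x) ∷ Q) a₁ → ManyConnected j ((a₁ , x) ∷ Q) a₂ →
         ManyConnected (suc j) ((a₁ , x) ∷ (a₂ , x) ∷ Q) x
  join {j} (many V₁ unique₁ big₁ conn₁) (many V₂ unique₂ big₂ conn₂) = many
    (x ∷ V₁ ++ V₂)
    (AllP.++⁺ (All.map x∉₁ conn₁) (All.map x∉₂ conn₂) ∷ AllPairsP.++⁺ unique₁ unique₂ (All.map apart conn₁))
    big
    (here ∷ AllP.++⁺ (All.map up₁ conn₁) (All.map up₂ conn₂))
    where
    x∉₁ : ∀ {v} → Reach ((a₂ , x) ∷ Q) v a₁ → x ≢ v
    x∉₁ v~a₁ refl = bridge₁ (Reach-sym v~a₁)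
    x∉₂ : ∀ {v} → Reach ((a₁ , x) ∷ Q) v a₂ → x ≢ v
    x∉₂ v~a₂ refl = bridge₂ (Reach-sym v~a₂)
    apart : ∀ {v} → Reach ((a₂ , x) ∷ Q) v a₁ → All (v ≢_) V₂
    apart v~a₁ = All.map (λ { v~a₂ refl → disjoint v~a₁ v~a₂ }) conn₂
    up₁ : ∀ {v} → Reach ((a₂ , x) ∷ Q) v a₁ → Reach ((a₁ , x) ∷ (a₂ , x) ∷ Q) v x
    up₁ v~a₁ = Reach-mono there v~a₁ ▷ here refl
    up₂ : ∀ {v} → Reach ((a₁ , x) ∷ Q) v a₂ → Reach ((a₁ , x) ∷ (a₂ , x) ∷ Q) v x
    up₂ v~a₂ = Reach-mono (λ { (here e≡) → here e≡ ; (there e∈) → there (there e∈) }) v~a₂ ▷ there (here refl)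
    big : 2 ^ suc (suc j) ℕ.≤ length (x ∷ V₁ ++ V₂)
    big = begin
      2 ^ suc j ℕ.+ (2 ^ suc j ℕ.+ 0) ≤⟨ ℕP.+-mono-≤ big₁ (ℕP.+-mono-≤ big₂ z≤n) ⟩
      length V₁ ℕ.+ (length V₂ ℕ.+ 0) ≡⟨ cong (length V₁ ℕ.+_) (ℕP.+-identityʳ (length V₂)) ⟩
      length V₁ ℕ.+ length V₂        ≡⟨ ListP.length-++ V₁ ⟨
      length (V₁ ++ V₂)              ≤⟨ ℕP.n≤1+n _ ⟩
      length (x ∷ V₁ ++ V₂)          ∎
      where open ℕP.≤-Reasoning

indeg-pick : (R : Orientation n) (x : Fin n) → 1 ℕ.≤ indeg R x →
  Σ[ a ∈ Fin n ] Σ[ R′ ∈ Orientation n ] (R ↭ (a , x) ∷ R′) × indeg R x ≡ suc (indeg R′ x)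
indeg-pick ((a , b) ∷ R) x 1≤indeg with b ≟ x
... | yes refl = a , R , ↭-refl , refl
... | no b≢x with indeg-pick R x 1≤indeg
...   | a′ , R′ , R↭ , count =
  a′ , (a , b) ∷ R′ , ↭-trans (↭.prep (a , b) R↭) (↭.swap (a , b) (a′ , x) ↭-refl) ,
  trans count (cong (suc ∘ length) (sym (ListP.filter-reject (λ e → proj₂ e ≟ x) b≢x)))

TwoInEdges : Orientation n → Fin n → Set
TwoInEdges {n} R x = Σ[ a₁ ∈ Fin n ] Σ[ a₂ ∈ Fin n ] Σ[ R′ ∈ Orientation n ] R ↭ (a₁ , x) ∷ (a₂ , x) ∷ R′

two-in-edges : (R : Orientation n) (x : Fin n) → 2 ℕ.≤ indeg R x → TwoInEdges R x
two-in-edges R x 2≤indeg with indeg-pick R x (ℕP.≤-trans (s≤s z≤n) 2≤indeg)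
... | a₁ , R₁ , R↭ , count with indeg-pick R₁ x (ℕP.≤-pred (subst (2 ℕ.≤_) count 2≤indeg))
...   | a₂ , R′ , R₁↭ , _ = a₁ , a₂ , R′ , ↭-trans R↭ (↭.prep (a₁ , x) R₁↭)

module AtLocalOptimum {E : Orientation n} {L : ℕ} (acyclic : Acyclic E) (opt : LocalOpt L E)
                      {w : Fin n} (4≤disc : + 4 ≤ disc E w) where

  -- Local optimality gives disc x ≥ disc w − 2 ≥ 2 and the path contributes δ w x − 1 ≤ 0
  -- at x, so the edges off the path give x discrepancy, hence in-degree, at least 2.
  2≤indeg : ∀ {x P R} → E ↭ P ++ R → IsPath x P w → length P ℕ.≤ L → 2 ℕ.≤ indeg R x
  2≤indeg {x} {P} {R} E↭PR path short = ℤP.drop‿+≤+ (≤-by-slack _ nonneg (slack disc-x))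
    where
    disc-x : disc E x ≡ (δ w x - 1ℤ) + (+ indeg R x - + outdeg R x)
    disc-x = begin
      disc E x               ≡⟨ disc-↭ E↭PR x ⟩
      disc (P ++ R) x        ≡⟨ disc-++ P R x ⟩
      disc P x + disc R x    ≡⟨ cong (_+ disc R x) (disc-path path x) ⟩
      disc₁ x w x + disc R x ≡⟨ cong (λ d → (δ w x - d) + disc R x) (δ-diag x) ⟩
      (δ w x - 1ℤ) + disc R x ∎
      where open ≡-Reasoning
    slack : ∀ {dx} → dx ≡ (δ w x - 1ℤ) + (+ indeg R x - + outdeg R x) →
      + indeg R x - + 2 ≡ (dx + + 2 - disc E w) + (disc E w - + 4) + (1ℤ - δ w x) + + outdeg R x
    slack refl = regroup (disc E w) (δ w x) (+ indeg R x) (+ outdeg R x)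
      where
      regroup : ∀ dw δw i o → i - + 2 ≡ ((δw - 1ℤ) + (i - o) + + 2 - dw) + (dw - + 4) + (1ℤ - δw) + o
      regroup = solve-∀
    nonneg : 0ℤ ≤ (disc E x + + 2 - disc E w) + (disc E w - + 4) + (1ℤ - δ w x) + + outdeg R x
    nonneg = ℤP.+-mono-≤ (ℤP.+-mono-≤ (ℤP.+-mono-≤
      (ℤP.i≤j⇒0≤j-i (opt P R x w E↭PR path short))
      (ℤP.i≤j⇒0≤j-i 4≤disc))
      (ℤP.i≤j⇒0≤j-i (δ≤1 w x)))
      (+≤+ z≤n)

  in-tree : ∀ j {x P R} → E ↭ P ++ R → IsPath x P w → length P ℕ.+ j ℕ.≤ L → ManyConnected j R x
  in-tree j {x} {P} {R} E↭PR path short =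
    fork (two-in-edges R x (2≤indeg E↭PR path (ℕP.≤-trans (ℕP.m≤m+n (length P) j) short)))
    where
    fork : TwoInEdges R x → ManyConnected j R x
    fork (a₁ , a₂ , R′ , R↭) = ManyConnected-↭ (↭-sym R↭) (grow j short)
      where
      open Fork (Acyclic-↭ R↭ (Acyclic-++⁻ʳ P (Acyclic-↭ E↭PR acyclic)))
      E↭ : E ↭ P ++ (a₁ , x) ∷ (a₂ , x) ∷ R′
      E↭ = ↭-trans E↭PR (↭P.++⁺ˡ P R↭)
      grow : ∀ j → length P ℕ.+ j ℕ.≤ L → ManyConnected j ((a₁ , x) ∷ (a₂ , x) ∷ R′) x
      grow zero    _      = base
      grow (suc j) short′ = join
        (in-tree j {R = (a₂ , x) ∷ R′} (↭-trans E↭ (↭P.shift (a₁ , x) P _)) (cons path) longer)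
        (in-tree j {R = (a₁ , x) ∷ R′}
          (↭-trans E↭ (↭-trans (↭P.++⁺ˡ P (↭.swap (a₁ , x) (a₂ , x) ↭-refl)) (↭P.shift (a₂ , x) P _)))
          (cons path) longer)
        where
        longer : suc (length P) ℕ.+ j ℕ.≤ L
        longer = subst (ℕ._≤ L) (ℕP.+-suc (length P) j) short′

  2^1+L≤n : 2 ^ suc L ℕ.≤ n
  2^1+L≤n = ℕP.≤-trans big (Unique⇒length≤ unique)
    where open ManyConnected (in-tree L (↭-refl {x = E}) nil ℕP.≤-refl)

disc≤3 : ∀ {E : Orientation n} {L} → Acyclic E → LocalOpt L E → n ℕ.≤ 2 ^ L → ∀ w → disc E w ≤ + 3
disc≤3 {E = E} {L} acyclic opt n≤2^L w with disc E w ℤP.≤? + 3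
... | yes ≤3 = ≤3
... | no ≰3  = ⊥-elim (ℕP.<⇒≱ 2^L<2^1+L (ℕP.≤-trans 2^1+L≤n n≤2^L))
  where
  open AtLocalOptimum acyclic opt (ℤP.i<j⇒suc[i]≤j (ℤP.≰⇒> ≰3))
  2^L<2^1+L : 2 ^ L ℕ.< 2 ^ suc L
  2^L<2^1+L = ℕP.^-monoʳ-< 2 (s≤s (s≤s z≤n)) (ℕP.n<1+n L)

map-swap-involutive : (E : Orientation n) → map swap (map swap E) ≡ E
map-swap-involutive E = trans (sym (ListP.map-∘ E)) (ListP.map-id E)

SameGraph-map-swap : (E : Orientation n) → SameGraph E (map swap E)
SameGraph-map-swap E = ↭-reflexive (begin
  map undirected E               ≡⟨ ListP.map-cong (sym ∘ undirected-swap) E ⟩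
  map (undirected ∘ swap) E      ≡⟨ ListP.map-∘ E ⟩
  map undirected (map swap E)    ∎)
  where open ≡-Reasoning

IsPath-++ : ∀ {a b c : Fin n} {X Y} → IsPath a X b → IsPath b Y c → IsPath a (X ++ Y) c
IsPath-++ nil      q = q
IsPath-++ (cons p) q = cons (IsPath-++ p q)

IsPath-reverse : ∀ {u w : Fin n} {P} → IsPath u P w → IsPath w (reverse (map swap P)) u
IsPath-reverse nil = nil
IsPath-reverse (cons {u = u} {v = x} {P = P} path) =
  subst (λ Q → IsPath _ Q u) (sym (ListP.unfold-reverse (x , u) (map swap P))) (IsPath-++ (IsPath-reverse path) (cons nil))

LocalOpt-map-swap : ∀ {L} {E : Orientation n} → LocalOpt L E → LocalOpt L (map swap E)
LocalOpt-map-swap {E = E} opt P R u w swapE↭PR path short = ≤-by-slack _ (ℤP.i≤j⇒0≤j-i reversed) slack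
  where
  E↭ : E ↭ reverse (map swap P) ++ map swap R
  E↭ = begin
    E                                  ≡⟨ map-swap-involutive E ⟨
    map swap (map swap E)              ↭⟨ ↭P.map⁺ swap swapE↭PR ⟩
    map swap (P ++ R)                  ≡⟨ ListP.map-++ swap P R ⟩
    map swap P ++ map swap R           ↭⟨ ↭P.++⁺ʳ (map swap R) (↭P.↭-reverse (map swap P)) ⟨
    reverse (map swap P) ++ map swap R ∎
    where open ↭.PermutationReasoning
  reversed : disc E u ≤ disc E w + + 2
  reversed = opt _ _ w u E↭ (IsPath-reverse path)
    (subst (ℕ._≤ _) (sym (trans (ListP.length-reverse (map swap P)) (ListP.length-map swap P))) short)
  slack : (disc (map swap E) u + + 2) - disc (map swap E) w ≡ (disc E w + + 2) - disc E u
  slack = begin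
    (disc (map swap E) u + + 2) - disc (map swap E) w
      ≡⟨ cong₂ (λ du dw → (du + + 2) - dw) (disc-map-swap E u) (disc-map-swap E w) ⟩
    (- disc E u + + 2) - - disc E w
      ≡⟨ flip-signs (disc E u) (disc E w) ⟩
    (disc E w + + 2) - disc E u ∎
    where
    open ≡-Reasoning
    flip-signs : ∀ du dw → (- du + + 2) - - dw ≡ (dw + + 2) - du
    flip-signs = solve-∀

-3≤disc : ∀ {E : Orientation n} {L} → Acyclic E → LocalOpt L E → n ℕ.≤ 2 ^ L → ∀ w → - + 3 ≤ disc E w
-3≤disc {E = E} acyclic opt n≤2^L w = subst (- + 3 ≤_) (ℤP.neg-involutive (disc E w))
  (ℤP.neg-mono-≤ (subst (_≤ + 3) (disc-map-swap E w)
    (disc≤3 (Acyclic-SameGraph (SameGraph-map-swap E) acyclic) (LocalOpt-map-swap opt) n≤2^L w)))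

-- Amortised recourse

Flip-SameGraph : ∀ {L} {o o′ : Orientation n} {m} → Flip L o m o′ → SameGraph o o′
Flip-SameGraph {o = o} (flip {P = P} {R} o↭PR _ _ _) = begin
  map undirected o                                ↭⟨ ↭P.map⁺ undirected o↭PR ⟩
  map undirected (P ++ R)                         ≡⟨ ListP.map-++ undirected P R ⟩
  map undirected P ++ map undirected R            ↭⟨ ↭P.++⁺ʳ (map undirected R) (SameGraph-map-swap P) ⟩
  map undirected (map swap P) ++ map undirected R ≡⟨ ListP.map-++ undirected (map swap P) R ⟨
  map undirected (map swap P ++ R)                ∎
  where open ↭.PermutationReasoning

-- Since disc w ≥ disc u + 3, moving two units of discrepancy from w to u lowers Φ by at
-- least 4 ≥ 4m/L.
Flip-potential : ∀ {L} {o o′ : Orientation n} {m} → Flip L o m o′ → + 4 * + m + + L * Φ (disc o′) ≤ + L * Φ (disc o)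
Flip-potential {L = L} {o} (flip {P = P} {R} {u} {w} o↭PR path short improving) =
  ≤-by-slack _ nonneg (slack (+ L) (Φ (disc o)) (Φ (disc (map swap P ++ R))) (disc o u) (disc o w) (+ length P))
  where
  f = disc o
  bound = Φ f + + 2 * (- + 2) * (f w - f u) + + 2 * ((- + 2) * (- + 2))
  decrease : Φ (disc (map swap P ++ R)) ≤ bound
  decrease = subst (_≤ bound) (sym (Φ-cong (disc-reverse-path o↭PR path))) (Φ-shift f (- + 2) u w)
  gap : 1ℤ + (f u + + 2) ≤ f w
  gap = ℤP.i<j⇒suc[i]≤j improving
  nonneg : 0ℤ ≤ + L * (bound - Φ (disc (map swap P ++ R))) + + 4 * + L * (f w - (1ℤ + (f u + + 2))) + + 4 * (+ L - + length P)
  nonneg = ℤP.+-mono-≤ (ℤP.+-mono-≤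
    (0≤i*j {+ L} (+≤+ z≤n) (ℤP.i≤j⇒0≤j-i decrease))
    (0≤i*j {+ 4 * + L} (0≤i*j {+ 4} {+ L} (+≤+ z≤n) (+≤+ z≤n)) (ℤP.i≤j⇒0≤j-i gap)))
    (0≤i*j {+ 4} (+≤+ z≤n) (ℤP.i≤j⇒0≤j-i (+≤+ short)))
  slack : ∀ L Φ Φ′ fu fw m → L * Φ - (+ 4 * m + L * Φ′) ≡
    L * ((Φ + + 2 * (- + 2) * (fw - fu) + + 2 * ((- + 2) * (- + 2))) - Φ′)
      + + 4 * L * (fw - (1ℤ + (fu + + 2))) + + 4 * (L - m)
  slack = solve-∀

LS-SameGraph : ∀ {L} {o o′ : Orientation n} {k} → LS L o k o′ → SameGraph o o′
LS-SameGraph (done _)         = ↭-refl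
LS-SameGraph (step move rest) = ↭-trans (Flip-SameGraph move) (LS-SameGraph rest)

LS-LocalOpt : ∀ {L} {o o′ : Orientation n} {k} → LS L o k o′ → LocalOpt L o′
LS-LocalOpt (done opt)    = opt
LS-LocalOpt (step _ rest) = LS-LocalOpt rest

LS-potential : ∀ {L} {o o′ : Orientation n} {k} → LS L o k o′ → + 4 * + k + + L * Φ (disc o′) ≤ + L * Φ (disc o)
LS-potential (done _) = ℤP.≤-reflexive (ℤP.+-identityˡ _)
LS-potential {L = L} {o} (step {o₁ = o₁} {o′} {m} {k} move rest) =
  ≤-by-slack _ (ℤP.+-mono-≤ (ℤP.i≤j⇒0≤j-i (Flip-potential move)) (ℤP.i≤j⇒0≤j-i (LS-potential rest)))
    (trans (cong (λ c → + L * Φ (disc o) - (+ 4 * c + + L * Φ (disc o′))) (ℤP.pos-+ m k))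
      (slack (+ L) (Φ (disc o)) (Φ (disc o₁)) (Φ (disc o′)) (+ m) (+ k)))
  where
  slack : ∀ L Φ Φ₁ Φ′ m k → L * Φ - (+ 4 * (m + k) + L * Φ′) ≡
    (L * Φ - (+ 4 * m + L * Φ₁)) + (L * Φ₁ - (+ 4 * k + L * Φ′))
  slack = solve-∀

DiscAtMost : ℕ → Orientation n → Set
DiscAtMost {n} d o = (v : Fin n) → - + d ≤ disc o v × disc o v ≤ + d

Φ-shift≤14 : (f : Fin n → ℤ) (a b : Fin n) → - + 3 ≤ f a → f b ≤ + 3 →
  Φ (λ x → f x + 1ℤ * disc₁ a b x) ≤ Φ f + + 14
Φ-shift≤14 f a b -3≤fa fb≤3 = ℤP.≤-trans (Φ-shift f 1ℤ a b) (≤-by-slack _ nonneg (slack (Φ f) (f a) (f b)))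
  where
  nonneg : 0ℤ ≤ + 2 * (+ 3 - f b) + + 2 * (f a - - + 3)
  nonneg = ℤP.+-mono-≤ (0≤i*j {+ 2} (+≤+ z≤n) (ℤP.i≤j⇒0≤j-i fb≤3))
                       (0≤i*j {+ 2} (+≤+ z≤n) (ℤP.i≤j⇒0≤j-i -3≤fa))
  slack : ∀ Φ fa fb → (Φ + + 14) - (Φ + + 2 * 1ℤ * (fb - fa) + + 2 * (1ℤ * 1ℤ)) ≡ + 2 * (+ 3 - fb) + + 2 * (fa - - + 3)
  slack = solve-∀

disc-insert : (a b : Fin n) (o : Orientation n) (x : Fin n) → disc ((a , b) ∷ o) x ≡ disc o x + 1ℤ * disc₁ a b x
disc-insert a b o x = trans (disc-∷ (a , b) o x) (reorder (disc₁ a b x) (disc o x))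
  where
  reorder : ∀ d₁ d → d₁ + d ≡ d + 1ℤ * d₁
  reorder = solve-∀

disc-delete : ∀ {a b : Fin n} {o o′} → o ↭ (a , b) ∷ o′ → (x : Fin n) → disc o′ x ≡ disc o x + 1ℤ * disc₁ b a x
disc-delete {a = a} {b} {o} {o′} o↭ x = reorder (δ a x) (δ b x) (disc o′ x) (trans (disc-↭ o↭ x) (disc-∷ (a , b) o′ x))
  where
  reorder : ∀ δa δb d′ {d} → d ≡ (δb - δa) + d′ → d′ ≡ d + 1ℤ * (δa - δb)
  reorder δa δb d′ refl = solve′ δa δb d′
    where
    solve′ : ∀ δa δb d′ → d′ ≡ ((δb - δa) + d′) + 1ℤ * (δa - δb)
    solve′ = solve-∀

Apply-potential : ∀ {o o′ : Orientation n} {upd} → DiscAtMost 3 o → Apply o upd o′ → Φ (disc o′) ≤ Φ (disc o) + + 14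
Apply-potential {o = o} bounded (ins-uv {u = u} {v}) =
  subst (_≤ _) (sym (Φ-cong (disc-insert u v o))) (Φ-shift≤14 (disc o) u v (proj₁ (bounded u)) (proj₂ (bounded v)))
Apply-potential {o = o} bounded (ins-vu {u = u} {v}) =
  subst (_≤ _) (sym (Φ-cong (disc-insert v u o))) (Φ-shift≤14 (disc o) v u (proj₁ (bounded v)) (proj₂ (bounded u)))
Apply-potential {o = o} bounded (del-uv {u = u} {v} o↭) =
  subst (_≤ _) (sym (Φ-cong (disc-delete o↭))) (Φ-shift≤14 (disc o) v u (proj₁ (bounded v)) (proj₂ (bounded u)))
Apply-potential {o = o} bounded (del-vu {u = u} {v} o↭) =
  subst (_≤ _) (sym (Φ-cong (disc-delete o↭))) (Φ-shift≤14 (disc o) u v (proj₁ (bounded u)) (proj₂ (bounded v)))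

LS-DiscAtMost3 : ∀ {L} {o o′ : Orientation n} {k} → n ℕ.≤ 2 ^ L → Forest o → LS L o k o′ → DiscAtMost 3 o′
LS-DiscAtMost3 n≤2^L forest search v = -3≤disc acyclic opt n≤2^L v , disc≤3 acyclic opt n≤2^L v
  where
  acyclic = Acyclic-SameGraph (LS-SameGraph search) (Forest⇒Acyclic forest)
  opt = LS-LocalOpt search

Exec-DiscAtMost3 : ∀ {L us k} {o : Orientation n} → n ℕ.≤ 2 ^ L → Exec L us k o → DiscAtMost 3 o
Exec-DiscAtMost3 _     start                   _ = ℤ.-≤+ , +≤+ z≤n
Exec-DiscAtMost3 n≤2^L (next _ _ forest search)  = LS-DiscAtMost3 n≤2^L forest search

-- Each update raises Φ by at most 14 (Φ-shift≤14); rounding up to 16 = 4 · 4 makes 4 the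
-- constant for both the discrepancy and the recourse bound.
Exec-budget : ∀ {L us k} {o : Orientation n} → n ℕ.≤ 2 ^ L → Exec L us k o →
  + 4 * + k + + L * Φ (disc o) ≤ + 16 * + L * + length us
Exec-budget {n} {L} _ start = ℤP.≤-reflexive (begin
  + 4 * + 0 + + L * sum {n} (λ _ → 0ℤ) ≡⟨ ℤP.+-identityˡ _ ⟩
  + L * sum {n} (λ _ → 0ℤ)              ≡⟨ cong (λ s → + L * s) (sum-replicate-zero n) ⟩
  + L * 0ℤ                              ≡⟨ ℤP.*-zeroʳ (+ L) ⟩
  0ℤ                                    ≡⟨ ℤP.*-zeroʳ (+ 16 * + L) ⟨
  + 16 * + L * 0ℤ                       ∎)
  where open ≡-Reasoning
Exec-budget {L = L} n≤2^L (next {us = us} {k} {o} {o₁ = o₁} {m} {o₂} run update _ search) =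
  ≤-by-slack _ nonneg slack
  where
  nonneg : 0ℤ ≤ (+ 16 * + L * + length us - (+ 4 * + k + + L * Φ (disc o)))
              + (+ L * Φ (disc o₁) - (+ 4 * + m + + L * Φ (disc o₂)))
              + + L * ((Φ (disc o) + + 14) - Φ (disc o₁)) + + 2 * + L
  nonneg = ℤP.+-mono-≤ (ℤP.+-mono-≤ (ℤP.+-mono-≤
    (ℤP.i≤j⇒0≤j-i (Exec-budget n≤2^L run))
    (ℤP.i≤j⇒0≤j-i (LS-potential search)))
    (0≤i*j {+ L} (+≤+ z≤n) (ℤP.i≤j⇒0≤j-i (Apply-potential (Exec-DiscAtMost3 n≤2^L run) update))))
    (0≤i*j {+ 2} {+ L} (+≤+ z≤n) (+≤+ z≤n))
  slack : + 16 * + L * + suc (length us) - (+ 4 * + (k ℕ.+ m) + + L * Φ (disc o₂)) ≡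
          (+ 16 * + L * + length us - (+ 4 * + k + + L * Φ (disc o)))
            + (+ L * Φ (disc o₁) - (+ 4 * + m + + L * Φ (disc o₂)))
            + + L * ((Φ (disc o) + + 14) - Φ (disc o₁)) + + 2 * + L
  slack = trans (cong₂ (λ l c → + 16 * + L * l - (+ 4 * c + + L * Φ (disc o₂))) (ℤP.pos-+ 1 (length us)) (ℤP.pos-+ k m))
    (regroup (+ L) (+ length us) (+ k) (+ m) (Φ (disc o)) (Φ (disc o₁)) (Φ (disc o₂)))
    where
    regroup : ∀ L l k m Φ Φ₁ Φ₂ → + 16 * L * (1ℤ + l) - (+ 4 * (k + m) + L * Φ₂) ≡
      (+ 16 * L * l - (+ 4 * k + L * Φ)) + (L * Φ₁ - (+ 4 * m + L * Φ₂)) + L * ((Φ + + 14) - Φ₁) + + 2 * L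
    regroup = solve-∀

-d≤i≤d⇒∣i∣≤d : ∀ {d i} → - + d ≤ i → i ≤ + d → ∣ i ∣ ℕ.≤ d
-d≤i≤d⇒∣i∣≤d {d}     {+ _}      _    i≤d = ℤP.drop‿+≤+ i≤d
-d≤i≤d⇒∣i∣≤d {suc d} { -[1+ _ ]} -d≤i _  = s≤s (ℤP.drop‿-≤- -d≤i)

recourse-bound : ∀ {L l k} P → 0ℤ ≤ P → + 4 * + k + + L * P ≤ + 16 * + L * + l → k ℕ.≤ 4 ℕ.* L ℕ.* l
recourse-bound {L} {l} {k} P 0≤P budget = ℕP.*-cancelˡ-≤ 4 (ℤP.drop‿+≤+ (begin
  + (4 ℕ.* k)                  ≡⟨ ℤP.pos-* 4 k ⟩
  + 4 * + k                    ≡⟨ ℤP.+-identityʳ _ ⟨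
  + 4 * + k + 0ℤ               ≤⟨ ℤP.+-monoʳ-≤ (+ 4 * + k) (0≤i*j {+ L} (+≤+ z≤n) 0≤P) ⟩
  + 4 * + k + + L * P          ≤⟨ budget ⟩
  + 16 * + L * + l             ≡⟨ cong (_* + l) (ℤP.pos-* 16 L) ⟨
  + (16 ℕ.* L) * + l           ≡⟨ ℤP.pos-* (16 ℕ.* L) l ⟨
  + (16 ℕ.* L ℕ.* l)           ≡⟨ cong +_ (regroup L l) ⟩
  + (4 ℕ.* (4 ℕ.* L ℕ.* l))    ∎))
  where
  open ℤP.≤-Reasoning
  regroup : ∀ L l → 16 ℕ.* L ℕ.* l ≡ 4 ℕ.* (4 ℕ.* L ℕ.* l)
  regroup = ℕSolver.solve-∀

lemma5p4 : Σ ℕ λ C → ∀ (n : ℕ) (us : List (Update n)) (k : ℕ) (o : Orientation n) →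
    Exec ⌈log₂ n ⌉ us k o →
    ((v : Fin n) → ∣ disc o v ∣ ℕ.≤ C) × (k ℕ.≤ C ℕ.* ⌈log₂ n ⌉ ℕ.* length us)
lemma5p4 = 4 , λ n us k o run →
  let n≤2^L = n≤2^⌈log₂n⌉ n
      bounded = Exec-DiscAtMost3 n≤2^L run
  in (λ v → ℕP.m≤n⇒m≤1+n (-d≤i≤d⇒∣i∣≤d (proj₁ (bounded v)) (proj₂ (bounded v)))) ,
     recourse-bound {⌈log₂ n ⌉} {length us} (Φ (disc o)) (0≤Φ (disc o)) (Exec-budget n≤2^L run)
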